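{- Let $n$ be a positive integer and let $S$ be an extraTrib all of whose terms are divisible by $n$. Then the number of the row of the Trithoff array that coincides with a tail of $S$ is congruent to $1$ modulo $n$.
   Context: An extraTrib is a two-sided integer sequence $(S_i)_{i\in\mathbb Z}$ with $S_i=S_{i-1}+S_{i-2}+S_{i-3}$ for all $i$ and $S_i>0$ for all large $i$. Tribonacci numbers: $T_0=0,T_1=0,T_2=1$, $T_n=T_{n-1}+T_{n-2}+T_{n-3}$. Every $N\ge0$ has a unique canonical Tribonacci representation $N=\sum_i d_iT_{i+3}$ ($d_i\in\{0,1\}$, no three consecutive $1$s); $\operatorname{out}(N)=\sum_i d_iT_{i+4}$. Trithoff array: $T_{r,1}$ is the $r$-th smallest positive integer whose canonical representation has $d_0=1$, $T_{r,c+1}=\operatorname{out}(T_{r,c})$; rows are numbered $1,2,3,\dots$. Every extraTrib has a tail equal to exactly one row of this array. -}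

module Defs where

open import Data.Nat using (ℕ; zero; suc; _+_; _*_; _<_)
open import Data.Integer as ℤ using (ℤ; +_)
open import Data.Bool using (Bool; true; false)
open import Data.List using (List; []; _∷_; length)
open import Data.List.Membership.Propositional using (_∈_)
open import Data.List.Relation.Unary.Unique.Propositional using (Unique)
open import Data.Product using (Σ; ∃; _×_)
open import Function.Bundles using (_⇔_)
open import Relation.Binary.PropositionalEquality using (_≡_)

trib : ℕ → ℕ
trib 0 = 0
trib 1 = 0
trib 2 = 1
trib (suc (suc (suc n))) = trib (suc (suc n)) + trib (suc n) + trib n

IsExtraTrib : (ℤ → ℤ) → Set
IsExtraTrib S =
  (∀ i → S i ≡ S (i ℤ.- ℤ.+ 1) ℤ.+ S (i ℤ.- ℤ.+ 2) ℤ.+ S (i ℤ.- ℤ.+ 3))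
  × (∃ λ M → ∀ i → M ℤ.≤ i → ℤ.0ℤ ℤ.< S i)

-- A digit string d₀ d₁ d₂ … (d₀ first).
Digits : Set
Digits = List Bool

bit : Bool → ℕ
bit true = 1
bit false = 0

valFrom : ℕ → Digits → ℕ
valFrom k [] = 0
valFrom k (d ∷ ds) = bit d * trib k + valFrom (suc k) ds

val : Digits → ℕ
val = valFrom 3

outVal : Digits → ℕ
outVal = valFrom 4

NoThreeOnes : Digits → Set
NoThreeOnes [] = Data.Unit.⊤ where import Data.Unit
NoThreeOnes (true ∷ true ∷ true ∷ ds) = Data.Empty.⊥ where import Data.Empty
NoThreeOnes (d ∷ ds) = NoThreeOnes ds

-- ds is a canonical Tribonacci representation of N
-- (unique up to trailing zeros, which affect neither d₀ nor out).
IsCanonicalRep : ℕ → Digits → Set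
IsCanonicalRep N ds = (val ds ≡ N) × NoThreeOnes ds

d₀ : Digits → Bool
d₀ [] = false
d₀ (d ∷ _) = d

HasD0 : ℕ → Set
HasD0 N = ∃ λ ds → IsCanonicalRep N ds × (d₀ ds ≡ true)

Out : ℕ → ℕ → Set
Out N M = ∃ λ ds → IsCanonicalRep N ds × (outVal ds ≡ M)

-- m is the r-th smallest positive integer with d₀ = 1 (r ≥ 1):
-- m is such an integer and the positive integers k < m with d₀ = 1
-- form a duplicate-free list of length r - 1.
IsRowStart : ℕ → ℕ → Set
IsRowStart r m =
  (0 < m) × HasD0 m ×
  (Σ (List ℕ) λ xs → Unique xs × (suc (length xs) ≡ r) ×
     (∀ k → (k ∈ xs) ⇔ ((0 < k) × (k < m) × HasD0 k)))

data TrithoffEntry (r : ℕ) : ℕ → ℕ → Set where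
  first : ∀ {m} → IsRowStart r m → TrithoffEntry r 1 m
  next  : ∀ {c u v} → TrithoffEntry r (suc c) u → Out u v → TrithoffEntry r (suc (suc c)) v

TailIsRow : (ℤ → ℤ) → ℕ → Set
TailIsRow S r = ∃ λ k → ∀ (c : ℕ) → ∃ λ v → TrithoffEntry r (suc c) v × (S (k ℤ.+ + c) ≡ + v)

-- Write the start m of row r canonically as Σ dᵢ Tᵢ₊₃ (so d₀ = 1); the next two entries of the row are
-- Σ dᵢ Tᵢ₊₄ and Σ dᵢ Tᵢ₊₅. Adding 1 to a canonical representation raises Σ dᵢ (Tᵢ + Tᵢ₊₁) by exactly d₀,
-- so this sum counts the integers below m whose representation has d₀ = 1, i.e. r = 1 + Σ dᵢ (Tᵢ + Tᵢ₊₁).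
-- Digitwise, 2 Tᵢ₊₃ + Tᵢ₊₄ = Tᵢ₊₅ + (Tᵢ + Tᵢ₊₁); hence if n divides the first three entries of the row
-- (three consecutive terms of S), it divides r - 1.

module Submission where

open import Defs
open import Data.Bool using (true; false)
import Data.Bool as Bool
open import Data.Empty using (⊥-elim)
open import Data.Integer as ℤ using (ℤ; +_)
open import Data.Integer.Divisibility using (_∣_)
open import Data.List using (List; []; _∷_; _++_; _∷ʳ_; length; replicate; filter; downFrom)
open import Data.List.Membership.Propositional using (_∈_)
open import Data.List.Membership.Propositional.Properties using (∈-filter⁺; ∈-filter⁻; ∈-downFrom⁺; ∈-downFrom⁻)
open import Data.List.Membership.Propositional.Properties.WithK using (unique∧set⇒bag)
open import Data.List.Properties using (++-assoc; ++-identityʳ; length-++; length-replicate)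
open import Data.List.Relation.Binary.BagAndSetEquality using (∼bag⇒↭)
open import Data.List.Relation.Binary.Permutation.Propositional.Properties using (↭-length)
open import Data.List.Relation.Unary.Unique.Propositional.Properties using (filter⁺; downFrom⁺)
open import Data.List.Reverse using (Reverse; []; _∶_∶ʳ_; reverseView)
open import Data.Nat using (ℕ; zero; suc; _+_; _*_; _≤_; _<_; z≤n; s≤s; NonZero; _%_; _<?_)
open import Data.Nat.Divisibility using (∣m∣n⇒∣m+n; ∣n⇒∣m*n; ∣m+n∣m⇒∣n) renaming (_∣_ to _∣ᴺ_)
open import Data.Nat.DivMod using (%-remove-+ʳ)
open import Data.Nat.Properties
open import Data.Nat.Tactic.RingSolver using (solve-∀)
open import Data.Product using (∃-syntax; _×_; _,_; proj₂)
open import Data.Sum using (inj₁; inj₂)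
open import Data.Unit using (tt)
open import Function.Bundles using (_⇔_; Equivalence; mk⇔)
open import Relation.Binary.PropositionalEquality
open import Relation.Nullary using (¬_; Dec; yes; no; contradiction)

trib-≤-suc : ∀ k → trib k ≤ trib (suc k)
trib-≤-suc 0 = z≤n
trib-≤-suc 1 = z≤n
trib-≤-suc 2 = ≤-refl
trib-≤-suc (suc (suc (suc k))) = ≤-trans (m≤m+n _ _) (m≤m+n _ _)

mono-≤-from-suc : ∀ (f : ℕ → ℕ) → (∀ n → f n ≤ f (suc n)) → ∀ {m n} → m ≤ n → f m ≤ f n
mono-≤-from-suc f step {zero}  {zero}  _ = ≤-refl
mono-≤-from-suc f step {m}     {suc n} m≤1+n with m≤n⇒m<n∨m≡n m≤1+n
... | inj₁ (s≤s m≤n) = ≤-trans (mono-≤-from-suc f step m≤n) (step n)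
... | inj₂ refl      = ≤-refl

trib-mono-≤ : ∀ {m n} → m ≤ n → trib m ≤ trib n
trib-mono-≤ = mono-≤-from-suc trib trib-≤-suc

trib-cancel-< : ∀ {m n} → trib m < trib n → m < n
trib-cancel-< {m} {n} lt with m <? n
... | yes m<n = m<n
... | no m≮n  = contradiction (trib-mono-≤ (≮⇒≥ m≮n)) (<⇒≱ lt)

trib-+-≤ : ∀ k → trib k + trib (1 + k) ≤ trib (2 + k)
trib-+-≤ zero    = z≤n
trib-+-≤ (suc k) = ≤-trans (≤-reflexive (+-comm (trib (1 + k)) _)) (m≤m+n _ (trib k))

trib-recurrence : ∀ k → trib k + trib (1 + k) + trib (2 + k) ≡ trib (3 + k)
trib-recurrence k = lemma (trib k) (trib (1 + k)) (trib (2 + k))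
  where
  lemma : ∀ t₀ t₁ t₂ → t₀ + t₁ + t₂ ≡ t₂ + t₁ + t₀
  lemma = solve-∀

trib-identity : ∀ k → 2 * trib (3 + k) + trib (4 + k) ≡ trib (5 + k) + (trib k + trib (1 + k))
trib-identity k = lemma (trib k) (trib (1 + k)) (trib (2 + k)) (trib (4 + k))
  where
  lemma : ∀ t₀ t₁ t₂ t₄ → 2 * (t₂ + t₁ + t₀) + t₄ ≡ t₄ + (t₂ + t₁ + t₀) + t₂ + (t₀ + t₁)
  lemma = solve-∀

length-∷ʳ : ∀ (xs : Digits) x → length (xs ∷ʳ x) ≡ suc (length xs)
length-∷ʳ xs x = trans (length-++ xs) (+-comm (length xs) 1)

valFrom-∷ʳ-false : ∀ k xs → valFrom k (xs ∷ʳ false) ≡ valFrom k xs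
valFrom-∷ʳ-false k []       = refl
valFrom-∷ʳ-false k (x ∷ xs) = cong (λ v → bit x * trib k + v) (valFrom-∷ʳ-false (suc k) xs)

valFrom-∷ʳ-true : ∀ k xs → valFrom k (xs ∷ʳ true) ≡ valFrom k xs + trib (length xs + k)
valFrom-∷ʳ-true k []       = trans (+-identityʳ (trib k + 0)) (+-identityʳ (trib k))
valFrom-∷ʳ-true k (x ∷ xs) rewrite valFrom-∷ʳ-true (suc k) xs | +-suc (length xs) k =
  sym (+-assoc (bit x * trib k) _ _)

NoThreeOnes-∷⁻ : ∀ d ds → NoThreeOnes (d ∷ ds) → NoThreeOnes ds
NoThreeOnes-∷⁻ false ds                  h = h
NoThreeOnes-∷⁻ true  []                  h = h
NoThreeOnes-∷⁻ true  (false ∷ ds)        h = h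
NoThreeOnes-∷⁻ true  (true ∷ [])         h = h
NoThreeOnes-∷⁻ true  (true ∷ false ∷ ds) h = h

NoThreeOnes-++⁻ˡ : ∀ xs ys → NoThreeOnes (xs ++ ys) → NoThreeOnes xs
NoThreeOnes-++⁻ˡ []                         ys h = tt
NoThreeOnes-++⁻ˡ (false ∷ xs)               ys h = NoThreeOnes-++⁻ˡ xs ys h
NoThreeOnes-++⁻ˡ (true ∷ [])                ys h = tt
NoThreeOnes-++⁻ˡ (true ∷ false ∷ xs)        ys h = NoThreeOnes-++⁻ˡ xs ys h
NoThreeOnes-++⁻ˡ (true ∷ true ∷ [])         ys h = tt
NoThreeOnes-++⁻ˡ (true ∷ true ∷ false ∷ xs) ys h = NoThreeOnes-++⁻ˡ xs ys h

NoThreeOnes-∷ʳ⁻ : ∀ xs x → NoThreeOnes (xs ∷ʳ x) → NoThreeOnes xs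
NoThreeOnes-∷ʳ⁻ xs x = NoThreeOnes-++⁻ˡ xs (x ∷ [])

¬NoThreeOnes-∷ʳ-111 : ∀ ws → ¬ NoThreeOnes (ws ∷ʳ true ∷ʳ true ∷ʳ true)
¬NoThreeOnes-∷ʳ-111 []       ()
¬NoThreeOnes-∷ʳ-111 (w ∷ ws) h = ¬NoThreeOnes-∷ʳ-111 ws (NoThreeOnes-∷⁻ w _ h)

val<trib : ∀ {ds} → Reverse ds → NoThreeOnes ds → val ds < trib (length ds + 3)
val<trib []                   _ = s≤s z≤n
val<trib (ys ∶ rs ∶ʳ false)   h rewrite valFrom-∷ʳ-false 3 ys | length-∷ʳ ys false =
  <-≤-trans (val<trib rs (NoThreeOnes-∷ʳ⁻ ys false h)) (trib-≤-suc (length ys + 3))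
val<trib (_ ∶ [] ∶ʳ true)     _ = s≤s (s≤s z≤n)
val<trib (_ ∶ (zs ∶ rs ∶ʳ false) ∶ʳ true) h
  rewrite valFrom-∷ʳ-true 3 (zs ∷ʳ false) | valFrom-∷ʳ-false 3 zs
        | length-∷ʳ (zs ∷ʳ false) true | length-∷ʳ zs false =
  <-≤-trans (+-monoˡ-< _ (val<trib rs hz)) (trib-+-≤ (length zs + 3))
  where
  hz : NoThreeOnes zs
  hz = NoThreeOnes-∷ʳ⁻ zs false (NoThreeOnes-∷ʳ⁻ (zs ∷ʳ false) true h)
val<trib (_ ∶ (_ ∶ [] ∶ʳ true) ∶ʳ true) _ = s≤s (s≤s (s≤s (s≤s z≤n)))
val<trib (_ ∶ (_ ∶ (ws ∶ rs ∶ʳ false) ∶ʳ true) ∶ʳ true) h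
  rewrite valFrom-∷ʳ-true 3 (ws ∷ʳ false ∷ʳ true) | valFrom-∷ʳ-true 3 (ws ∷ʳ false) | valFrom-∷ʳ-false 3 ws
        | length-∷ʳ (ws ∷ʳ false ∷ʳ true) true | length-∷ʳ (ws ∷ʳ false) true | length-∷ʳ ws false =
  <-≤-trans (+-monoˡ-< _ (+-monoˡ-< _ (val<trib rs hw))) (≤-reflexive (trib-recurrence (length ws + 3)))
  where
  hw : NoThreeOnes ws
  hw = NoThreeOnes-∷ʳ⁻ ws false (NoThreeOnes-∷ʳ⁻ (ws ∷ʳ false) true (NoThreeOnes-∷ʳ⁻ (ws ∷ʳ false ∷ʳ true) true h))
val<trib (_ ∶ (_ ∶ (ws ∶ _ ∶ʳ true) ∶ʳ true) ∶ʳ true) h = ⊥-elim (¬NoThreeOnes-∷ʳ-111 ws h)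

trib≤val-∷ʳ-true : ∀ k ys → trib (length ys + k) ≤ valFrom k (ys ∷ʳ true)
trib≤val-∷ʳ-true k ys rewrite valFrom-∷ʳ-true k ys = m≤n+m _ _

zeros : ℕ → Digits
zeros a = replicate a false

infix 4 _≈₀_
_≈₀_ : Digits → Digits → Set
ds ≈₀ es = ∃[ xs ] ∃[ a ] ∃[ b ] (ds ≡ xs ++ zeros a × es ≡ xs ++ zeros b)

≈₀-refl : ∀ ds → ds ≈₀ ds
≈₀-refl ds = ds , 0 , 0 , sym (++-identityʳ ds) , sym (++-identityʳ ds)

++-zeros-∷ʳ-false : ∀ xs a → (xs ++ zeros a) ∷ʳ false ≡ xs ++ zeros (suc a)
++-zeros-∷ʳ-false xs a = trans (++-assoc xs (zeros a) (false ∷ [])) (cong (xs ++_) (zeros-∷ʳ a))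
  where
  zeros-∷ʳ : ∀ a → zeros a ∷ʳ false ≡ zeros (suc a)
  zeros-∷ʳ zero    = refl
  zeros-∷ʳ (suc a) = cong (false ∷_) (zeros-∷ʳ a)

≈₀-∷ʳ-falseˡ : ∀ {ds es} → ds ≈₀ es → ds ∷ʳ false ≈₀ es
≈₀-∷ʳ-falseˡ (xs , a , b , refl , q) = xs , suc a , b , ++-zeros-∷ʳ-false xs a , q

≈₀-∷ʳ-falseʳ : ∀ {ds es} → ds ≈₀ es → ds ≈₀ es ∷ʳ false
≈₀-∷ʳ-falseʳ (xs , a , b , p , refl) = xs , a , suc b , p , ++-zeros-∷ʳ-false xs b

≈₀-length⇒≡ : ∀ {ds es} → ds ≈₀ es → length ds ≡ length es → ds ≡ es
≈₀-length⇒≡ (xs , a , b , refl , refl) eq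
  rewrite length-++ xs {zeros a} | length-++ xs {zeros b} | length-replicate a {false} | length-replicate b {false}
  with refl ← +-cancelˡ-≡ (length xs) a b eq = refl

valFrom-≈₀ : ∀ {ds es} → ds ≈₀ es → ∀ k → valFrom k ds ≡ valFrom k es
valFrom-≈₀ (xs , a , b , refl , refl) k = trans (valFrom-++-zeros k xs a) (sym (valFrom-++-zeros k xs b))
  where
  valFrom-++-zeros : ∀ k xs a → valFrom k (xs ++ zeros a) ≡ valFrom k xs
  valFrom-++-zeros k []       zero    = refl
  valFrom-++-zeros k []       (suc a) = valFrom-++-zeros (suc k) [] a
  valFrom-++-zeros k (x ∷ xs) a       = cong (λ v → bit x * trib k + v) (valFrom-++-zeros (suc k) xs a)

d₀-≈₀ : ∀ {ds es} → ds ≈₀ es → d₀ ds ≡ d₀ es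
d₀-≈₀ (xs , a , b , refl , refl) = trans (d₀-++-zeros xs a) (sym (d₀-++-zeros xs b))
  where
  d₀-++-zeros : ∀ xs a → d₀ (xs ++ zeros a) ≡ d₀ xs
  d₀-++-zeros []      zero    = refl
  d₀-++-zeros []      (suc a) = refl
  d₀-++-zeros (_ ∷ _) a       = refl

0<val-∷ʳ-true : ∀ ys → 0 < val (ys ∷ʳ true)
0<val-∷ʳ-true ys = ≤-trans (trib-mono-≤ {3} (m≤n+m 3 (length ys))) (trib≤val-∷ʳ-true 3 ys)

-- T_{ℓ+3} ≤ val (ys ∷ʳ true) < T_{ℓ+4} for ℓ = length ys, so the value determines the position of the highest 1.
∷ʳ-true-length-≤ : ∀ ys zs → NoThreeOnes (zs ∷ʳ true) → val (ys ∷ʳ true) ≡ val (zs ∷ʳ true) → length ys ≤ length zs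
∷ʳ-true-length-≤ ys zs h eq = +-cancelʳ-≤ 3 (length ys) (length zs) (≤-pred (trib-cancel-< (begin-strict
    trib (length ys + 3)                   ≤⟨ trib≤val-∷ʳ-true 3 ys ⟩
    val (ys ∷ʳ true)                       ≡⟨ eq ⟩
    val (zs ∷ʳ true)                       <⟨ val<trib (reverseView (zs ∷ʳ true)) h ⟩
    trib (length (zs ∷ʳ true) + 3)         ≡⟨ cong (λ l → trib (l + 3)) (length-∷ʳ zs true) ⟩
    trib (suc (length zs) + 3)             ∎)))
  where open ≤-Reasoning

val-∷ʳ-true-cancel : ∀ ys zs → length ys ≡ length zs → val (ys ∷ʳ true) ≡ val (zs ∷ʳ true) → val ys ≡ val zs
val-∷ʳ-true-cancel ys zs l e rewrite valFrom-∷ʳ-true 3 ys | valFrom-∷ʳ-true 3 zs | l = +-cancelʳ-≡ _ _ _ e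

val-injective-≈₀ : ∀ {ds es} → Reverse ds → Reverse es → NoThreeOnes ds → NoThreeOnes es →
                   val ds ≡ val es → ds ≈₀ es
val-injective-≈₀ [] [] _ _ _ = ≈₀-refl []
val-injective-≈₀ (ys ∶ rs ∶ʳ false) res hds hes e =
  ≈₀-∷ʳ-falseˡ (val-injective-≈₀ rs res (NoThreeOnes-∷ʳ⁻ ys false hds) hes (trans (sym (valFrom-∷ʳ-false 3 ys)) e))
val-injective-≈₀ [] (zs ∶ rs ∶ʳ false) hds hes e =
  ≈₀-∷ʳ-falseʳ (val-injective-≈₀ [] rs hds (NoThreeOnes-∷ʳ⁻ zs false hes) (trans e (valFrom-∷ʳ-false 3 zs)))
val-injective-≈₀ rds@(_ ∶ _ ∶ʳ true) (zs ∶ rs ∶ʳ false) hds hes e =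
  ≈₀-∷ʳ-falseʳ (val-injective-≈₀ rds rs hds (NoThreeOnes-∷ʳ⁻ zs false hes) (trans e (valFrom-∷ʳ-false 3 zs)))
val-injective-≈₀ [] (zs ∶ _ ∶ʳ true) _ _ e = contradiction e (<⇒≢ (0<val-∷ʳ-true zs))
val-injective-≈₀ (ys ∶ _ ∶ʳ true) [] _ _ e = contradiction (sym e) (<⇒≢ (0<val-∷ʳ-true ys))
val-injective-≈₀ (ys ∶ rs ∶ʳ true) (zs ∶ rs′ ∶ʳ true) hds hes e
  with same ← ≤-antisym (∷ʳ-true-length-≤ ys zs hes e) (∷ʳ-true-length-≤ zs ys hds (sym e))
  with refl ← ≈₀-length⇒≡ (val-injective-≈₀ rs rs′ (NoThreeOnes-∷ʳ⁻ ys true hds) (NoThreeOnes-∷ʳ⁻ zs true hes)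
                                              (val-∷ʳ-true-cancel ys zs same e)) same
  = ≈₀-refl (ys ∷ʳ true)

canonical-unique : ∀ {N} ds es → IsCanonicalRep N ds → IsCanonicalRep N es → ds ≈₀ es
canonical-unique ds es (refl , hds) (e , hes) = val-injective-≈₀ (reverseView ds) (reverseView es) hds hes (sym e)

-- Adds Tₖ at the lowest position k of a string whose lowest digit is 0; three 1s at positions k, k+1, k+2
-- become a carry to position k+3, since Tₖ + Tₖ₊₁ + Tₖ₊₂ = Tₖ₊₃.
addLowest : Digits → Digits
addLowest []                      = true ∷ []
addLowest (_ ∷ [])                = true ∷ []
addLowest (_ ∷ false ∷ ds)        = true ∷ false ∷ ds
addLowest (_ ∷ true ∷ [])         = true ∷ true ∷ []
addLowest (_ ∷ true ∷ false ∷ ds) = true ∷ true ∷ false ∷ ds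
addLowest (_ ∷ true ∷ true ∷ ds)  = false ∷ false ∷ false ∷ addLowest ds

d₀≡false-after-11 : ∀ ds → NoThreeOnes (true ∷ true ∷ ds) → d₀ ds ≡ false
d₀≡false-after-11 []           _ = refl
d₀≡false-after-11 (false ∷ ds) _ = refl

NoThreeOnes-after-11 : ∀ ds → NoThreeOnes (true ∷ true ∷ ds) → NoThreeOnes ds
NoThreeOnes-after-11 ds h = NoThreeOnes-∷⁻ true ds (NoThreeOnes-∷⁻ true (true ∷ ds) h)

valFrom-addLowest : ∀ k ds → d₀ ds ≡ false → NoThreeOnes ds → valFrom k (addLowest ds) ≡ trib k + valFrom k ds
valFrom-addLowest k []                          _ _ = +-identityʳ (trib k + 0)
valFrom-addLowest k (false ∷ [])                _ _ = +-identityʳ (trib k + 0)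
valFrom-addLowest k (false ∷ false ∷ ds)        _ _ = cong (_+ valFrom (suc k) (false ∷ ds)) (+-identityʳ (trib k))
valFrom-addLowest k (false ∷ true ∷ [])         _ _ = cong (_+ valFrom (suc k) (true ∷ [])) (+-identityʳ (trib k))
valFrom-addLowest k (false ∷ true ∷ false ∷ ds) _ _ =
  cong (_+ valFrom (suc k) (true ∷ false ∷ ds)) (+-identityʳ (trib k))
valFrom-addLowest k (false ∷ true ∷ true ∷ ds)  _ h =
  trans (valFrom-addLowest (3 + k) ds (d₀≡false-after-11 ds h) (NoThreeOnes-after-11 ds h))
        (carry (trib k) (trib (1 + k)) (trib (2 + k)) (valFrom (3 + k) ds))
  where
  carry : ∀ t₀ t₁ t₂ v → t₂ + t₁ + t₀ + v ≡ t₀ + (t₁ + 0 + (t₂ + 0 + v))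
  carry = solve-∀

NoThreeOnes-addLowest : ∀ ds → d₀ ds ≡ false → NoThreeOnes ds → NoThreeOnes (addLowest ds)
NoThreeOnes-addLowest []                          _ _ = tt
NoThreeOnes-addLowest (false ∷ [])                _ _ = tt
NoThreeOnes-addLowest (false ∷ false ∷ ds)        _ h = h
NoThreeOnes-addLowest (false ∷ true ∷ [])         _ _ = tt
NoThreeOnes-addLowest (false ∷ true ∷ false ∷ ds) _ h = h
NoThreeOnes-addLowest (false ∷ true ∷ true ∷ ds)  _ h =
  NoThreeOnes-addLowest ds (d₀≡false-after-11 ds h) (NoThreeOnes-after-11 ds h)

-- Adding 1 = T₃ uses 1 + T₃ = T₄ and 1 + T₃ + T₄ = T₅.
increment : Digits → Digits
increment (true ∷ true ∷ ds) = false ∷ false ∷ addLowest ds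
increment (true ∷ ds)        = false ∷ addLowest ds
increment ds                 = addLowest ds

val-increment : ∀ ds → NoThreeOnes ds → val (increment ds) ≡ suc (val ds)
val-increment []                 _ = refl
val-increment (false ∷ ds)        h = valFrom-addLowest 3 (false ∷ ds) refl h
val-increment (true ∷ [])         _ = refl
val-increment (true ∷ false ∷ ds) h = valFrom-addLowest 4 (false ∷ ds) refl h
val-increment (true ∷ true ∷ ds)  h = valFrom-addLowest 5 ds (d₀≡false-after-11 ds h) (NoThreeOnes-after-11 ds h)

NoThreeOnes-increment : ∀ ds → NoThreeOnes ds → NoThreeOnes (increment ds)
NoThreeOnes-increment []                  _ = tt
NoThreeOnes-increment (false ∷ ds)        h = NoThreeOnes-addLowest (false ∷ ds) refl h
NoThreeOnes-increment (true ∷ [])         _ = tt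
NoThreeOnes-increment (true ∷ false ∷ ds) h = NoThreeOnes-addLowest (false ∷ ds) refl h
NoThreeOnes-increment (true ∷ true ∷ ds)  h =
  NoThreeOnes-addLowest ds (d₀≡false-after-11 ds h) (NoThreeOnes-after-11 ds h)

rep : ℕ → Digits
rep zero    = []
rep (suc m) = increment (rep m)

rep-canonical : ∀ m → IsCanonicalRep m (rep m)
rep-canonical zero = refl , tt
rep-canonical (suc m) with val-rep , h ← rep-canonical m =
  trans (val-increment (rep m) h) (cong suc val-rep) , NoThreeOnes-increment (rep m) h

rankWeight : Digits → ℕ
rankWeight ds = valFrom 0 ds + valFrom 1 ds

rankWeight-increment : ∀ ds → NoThreeOnes ds → rankWeight (increment ds) ≡ bit (d₀ ds) + rankWeight ds
rankWeight-increment []                  _ = refl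
rankWeight-increment (false ∷ ds)        h =
  cong₂ _+_ (valFrom-addLowest 0 (false ∷ ds) refl h) (valFrom-addLowest 1 (false ∷ ds) refl h)
rankWeight-increment (true ∷ [])         _ = refl
rankWeight-increment (true ∷ false ∷ ds) h =
  trans (cong₂ _+_ (valFrom-addLowest 1 (false ∷ ds) refl h) (valFrom-addLowest 2 (false ∷ ds) refl h)) (+-suc _ _)
rankWeight-increment (true ∷ true ∷ ds)  h =
  cong₂ _+_ (valFrom-addLowest 2 ds d₀≡false h′) (valFrom-addLowest 3 ds d₀≡false h′)
  where
  d₀≡false : d₀ ds ≡ false
  d₀≡false = d₀≡false-after-11 ds h
  h′ : NoThreeOnes ds
  h′ = NoThreeOnes-after-11 ds h

startsRow? : (k : ℕ) → Dec (d₀ (rep k) ≡ true)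
startsRow? k = d₀ (rep k) Bool.≟ true

rowStartsBelow : ℕ → List ℕ
rowStartsBelow m = filter startsRow? (downFrom m)

length-rowStartsBelow-suc : ∀ m → length (rowStartsBelow (suc m)) ≡ bit (d₀ (rep m)) + length (rowStartsBelow m)
length-rowStartsBelow-suc m with d₀ (rep m)
... | true  = refl
... | false = refl

rankWeight-rep : ∀ m → rankWeight (rep m) ≡ length (rowStartsBelow m)
rankWeight-rep zero    = refl
rankWeight-rep (suc m) = begin
  rankWeight (increment (rep m))               ≡⟨ rankWeight-increment (rep m) (proj₂ (rep-canonical m)) ⟩
  bit (d₀ (rep m)) + rankWeight (rep m)        ≡⟨ cong (_+_ (bit (d₀ (rep m)))) (rankWeight-rep m) ⟩
  bit (d₀ (rep m)) + length (rowStartsBelow m) ≡⟨ length-rowStartsBelow-suc m ⟨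
  length (rowStartsBelow (suc m))              ∎
  where open ≡-Reasoning

length-rowStartsBelow-mono : ∀ {m n} → m ≤ n → length (rowStartsBelow m) ≤ length (rowStartsBelow n)
length-rowStartsBelow-mono = mono-≤-from-suc (λ m → length (rowStartsBelow m))
  (λ m → ≤-trans (m≤n+m _ (bit (d₀ (rep m)))) (≤-reflexive (sym (length-rowStartsBelow-suc m))))

length-rowStartsBelow-< : ∀ {m n} → d₀ (rep m) ≡ true → m < n →
                          length (rowStartsBelow m) < length (rowStartsBelow n)
length-rowStartsBelow-< {m} d m<n =
  ≤-trans (≤-reflexive (cong (λ b → bit b + length (rowStartsBelow m)) (sym d)))
          (≤-trans (≤-reflexive (sym (length-rowStartsBelow-suc m))) (length-rowStartsBelow-mono m<n))

HasD0⇔startsRow : ∀ N → HasD0 N ⇔ (d₀ (rep N) ≡ true)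
HasD0⇔startsRow N = mk⇔
  (λ (ds , c , d) → trans (sym (d₀-≈₀ (canonical-unique ds (rep N) c (rep-canonical N)))) d)
  (λ d → rep N , rep-canonical N , d)

startsRow⇒0< : ∀ k → d₀ (rep k) ≡ true → 0 < k
startsRow⇒0< (suc k) _ = s≤s z≤n

rowStart-length : ∀ {r m} → IsRowStart r m → r ≡ suc (length (rowStartsBelow m))
rowStart-length {m = m} (_ , _ , xs , unique , refl , members) =
  cong suc (↭-length (∼bag⇒↭ (unique∧set⇒bag unique (filter⁺ startsRow? (downFrom⁺ m)) (mk⇔ ⊆rows rows⊆))))
  where
  ⊆rows : ∀ {k} → k ∈ xs → k ∈ rowStartsBelow m
  ⊆rows {k} k∈xs with _ , k<m , hd ← Equivalence.to (members k) k∈xs =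
    ∈-filter⁺ startsRow? (∈-downFrom⁺ k<m) (Equivalence.to (HasD0⇔startsRow k) hd)
  rows⊆ : ∀ {k} → k ∈ rowStartsBelow m → k ∈ xs
  rows⊆ {k} k∈rows with k∈downFrom , d ← ∈-filter⁻ startsRow? k∈rows =
    Equivalence.from (members k) (startsRow⇒0< k d , ∈-downFrom⁻ k∈downFrom , Equivalence.from (HasD0⇔startsRow k) d)

rowStart-number : ∀ {r m} → IsRowStart r m → r ≡ suc (rankWeight (rep m))
rowStart-number {m = m} start = trans (rowStart-length start) (cong suc (sym (rankWeight-rep m)))

rowStart⇒startsRow : ∀ {r m} → IsRowStart r m → d₀ (rep m) ≡ true
rowStart⇒startsRow {m = m} (_ , hd , _) = Equivalence.to (HasD0⇔startsRow m) hd

rowStart-≮ : ∀ {r m m′} → IsRowStart r m → IsRowStart r m′ → ¬ m < m′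
rowStart-≮ start start′ m<m′ =
  <⇒≢ (length-rowStartsBelow-< (rowStart⇒startsRow start) m<m′)
      (suc-injective (trans (sym (rowStart-length start)) (rowStart-length start′)))

rowStart-unique : ∀ {r m m′} → IsRowStart r m → IsRowStart r m′ → m ≡ m′
rowStart-unique start start′ = ≤-antisym (≮⇒≥ (rowStart-≮ start′ start)) (≮⇒≥ (rowStart-≮ start start′))

Out⇒≡outVal : ∀ {N M} ds → IsCanonicalRep N ds → Out N M → M ≡ outVal ds
Out⇒≡outVal ds c (es , c′ , refl) = valFrom-≈₀ (canonical-unique es ds c′ c) 4

Out-functional : ∀ {N M M′} → Out N M → Out N M′ → M ≡ M′
Out-functional out (ds , c , refl) = Out⇒≡outVal ds c out

Out-canonical : ∀ {N M} ds → IsCanonicalRep N ds → Out N M → IsCanonicalRep M (false ∷ ds)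
Out-canonical ds c out = sym (Out⇒≡outVal ds c out) , proj₂ c

TrithoffEntry-functional : ∀ {r c u v} → TrithoffEntry r c u → TrithoffEntry r c v → u ≡ v
TrithoffEntry-functional (first start) (first start′) = rowStart-unique start start′
TrithoffEntry-functional (next e out) (next e′ out′) with refl ← TrithoffEntry-functional e e′ =
  Out-functional out out′

valFrom-identity : ∀ k ds →
  2 * valFrom (3 + k) ds + valFrom (4 + k) ds ≡ valFrom (5 + k) ds + (valFrom k ds + valFrom (1 + k) ds)
valFrom-identity k []       = refl
valFrom-identity k (d ∷ ds) = begin
  2 * (b * t₃ + v₃) + (b * t₄ + v₄)             ≡⟨ expand b t₃ t₄ v₃ v₄ ⟩
  b * (2 * t₃ + t₄) + (2 * v₃ + v₄)             ≡⟨ cong₂ (λ t v → b * t + v) (trib-identity k)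
                                                                             (valFrom-identity (suc k) ds) ⟩
  b * (t₅ + (t₀ + t₁)) + (v₅ + (v₀ + v₁))       ≡⟨ collect b t₀ t₁ t₅ v₀ v₁ v₅ ⟩
  b * t₅ + v₅ + ((b * t₀ + v₀) + (b * t₁ + v₁)) ∎
  where
  open ≡-Reasoning
  b t₀ t₁ t₃ t₄ t₅ v₀ v₁ v₃ v₄ v₅ : ℕ
  b = bit d
  t₀ = trib k
  t₁ = trib (1 + k)
  t₃ = trib (3 + k)
  t₄ = trib (4 + k)
  t₅ = trib (5 + k)
  v₀ = valFrom (1 + k) ds
  v₁ = valFrom (2 + k) ds
  v₃ = valFrom (4 + k) ds
  v₄ = valFrom (5 + k) ds
  v₅ = valFrom (6 + k) ds
  expand : ∀ b t₃ t₄ v₃ v₄ → 2 * (b * t₃ + v₃) + (b * t₄ + v₄) ≡ b * (2 * t₃ + t₄) + (2 * v₃ + v₄)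
  expand = solve-∀
  collect : ∀ b t₀ t₁ t₅ v₀ v₁ v₅ →
            b * (t₅ + (t₀ + t₁)) + (v₅ + (v₀ + v₁)) ≡ b * t₅ + v₅ + ((b * t₀ + v₀) + (b * t₁ + v₁))
  collect = solve-∀

rankWeight-divisible : ∀ {d N₀ N₁ N₂} ds → IsCanonicalRep N₀ ds → Out N₀ N₁ → Out N₁ N₂ →
                       d ∣ᴺ N₀ → d ∣ᴺ N₁ → d ∣ᴺ N₂ → d ∣ᴺ rankWeight ds
rankWeight-divisible {d} ds c@(refl , _) out₁ out₂ d∣N₀ d∣N₁ d∣N₂
  with refl ← Out⇒≡outVal ds c out₁ | refl ← Out⇒≡outVal (false ∷ ds) (Out-canonical ds c out₁) out₂ =
  ∣m+n∣m⇒∣n (subst (d ∣ᴺ_) (valFrom-identity 0 ds) (∣m∣n⇒∣m+n (∣n⇒∣m*n 2 d∣N₀) d∣N₁)) d∣N₂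

mainTheorem18 : (n : ℕ) → .{{_ : NonZero n}} → (S : ℤ → ℤ) → IsExtraTrib S →
                  (∀ i → (+ n) ∣ S i) → (r : ℕ) → TailIsRow S r → r % n ≡ 1 % n
-- Only the tail entries S k, S (k + 1), S (k + 2) are used.
mainTheorem18 n S _ n∣S r (k , tail)
  with tail 0 | tail 1 | tail 2
... | _ , e₀ , S₀ | _ , e₁ , S₁ | _ , next (next (first {m} start) out₁) out₂ , S₂
  with refl ← TrithoffEntry-functional e₀ (first start)
     | refl ← TrithoffEntry-functional e₁ (next (first start) out₁) = begin
  r % n                        ≡⟨ cong (_% n) (rowStart-number start) ⟩
  (1 + rankWeight (rep m)) % n ≡⟨ %-remove-+ʳ 1 (rankWeight-divisible (rep m) (rep-canonical m) out₁ out₂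
                                                   (n∣entry S₀) (n∣entry S₁) (n∣entry S₂)) ⟩
  1 % n                        ∎
  where
  open ≡-Reasoning
  -- ℤ-divisibility between non-negative integers is ℕ-divisibility by definition.
  n∣entry : ∀ {c w} → S (k ℤ.+ + c) ≡ + w → n ∣ᴺ w
  n∣entry {c} eq = subst (+ n ∣_) eq (n∣S (k ℤ.+ + c))
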